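{- Let $n\in\mathbb{N}$ and let $\alpha$ be a composition. The number of words $w\in\mathcal{A}_n^*$ lying in any given hypoplactic class (i.e. with $\mathrm{QR}(w)=T$ for a fixed quasi-ribbon tableau $T$) whose quasi-ribbon tableau has shape $\alpha$ is \[\sum_{\beta\preceq\alpha}(-1)^{\ell(\alpha)-\ell(\beta)}\binom{|\beta|}{\beta_1,\dots,\beta_{\ell(\beta)}}\] if $\ell(\alpha)\le n$, and is $0$ otherwise.
   Context: $\mathcal{A}_n=\{1<\dots<n\}$. A composition $\alpha=(\alpha_1,\dots,\alpha_k)$ has positive parts, length $\ell(\alpha)=k$ and weight $|\alpha|=\alpha_1+\dots+\alpha_k$. For compositions $\alpha,\beta$ of equal weight, $\beta\preceq\alpha$ ($\beta$ coarser than $\alpha$) means every partial sum $\beta_1+\dots+\beta_{p'}$ ($p'<\ell(\beta)$) equals some partial sum $\alpha_1+\dots+\alpha_{m'}$ ($m'<\ell(\alpha)$); i.e. $\beta$ arises from $\alpha$ by merging consecutive parts. $\binom{|\beta|}{\beta_1,\dots}$ is the multinomial coefficient. A ribbon diagram of shape $\alpha$ has $\alpha_h$ boxes in row $h$, the leftmost box of each row directly below the rightmost box of the previous one. A quasi-ribbon tableau is such a diagram filled with positive integers, rows weakly increasing left to right, columns strictly increasing top to bottom. Insertion of $a$ into $T$: if no entry of $T$ is $\le a$ (or $T$ empty), create a cell $a$ with $T$ attached so its first cell is directly below $a$; if no entry is $>a$, attach a new cell $a$ directly right of the last cell of $T$; otherwise let $x$ be the last cell (along the ribbon, top-left to bottom-right)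 with entry $\le a$ and $z$ the next cell, and form the part of $T$ up to $x$, a new cell $a$ directly right of $x$, and the rest of $T$ from $z$ attached with $z$ directly below the new cell. $\mathrm{QR}(w)$ for $w=a_1\cdots a_k$ is obtained by successive insertion starting from the empty tableau. The hypoplactic class of $w$ in $\mathcal{A}_n^*$ is $\{u\in\mathcal{A}_n^*:\mathrm{QR}(u)=\mathrm{QR}(w)\}$. -}

module Defs where

open import Data.Nat using (ℕ; zero; suc; _+_; _*_; _≤_; _≤?_; _!; _/_; NonZero)
open import Data.Nat.Properties using (m*n≢0; _!≢0)
open import Data.Bool using (Bool; true; false; if_then_else_)
open import Data.Fin using (Fin; toℕ)
open import Data.List using (List; []; _∷_; _++_; [_]; map; length; foldl)
open import Data.Nat.ListAction using (sum)
open import Data.List.Relation.Unary.All using (All)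
open import Data.Maybe using (Maybe; just; nothing)
open import Data.Product using (_×_; _,_)
open import Data.Integer using (ℤ; +_; -_)
import Data.Integer as ℤ
open import Relation.Nullary.Decidable using (does)

Composition : Set
Composition = List ℕ

IsComposition : Composition → Set
IsComposition α = All (λ a → 1 ≤ a) α

ℓ : Composition → ℕ
ℓ = length

weight : Composition → ℕ
weight = sum

-- All compositions β ⪯ α, i.e. all compositions obtained from α by
-- merging consecutive parts (each listed exactly once: for each of the
-- ℓ(α)-1 gaps between consecutive parts we choose "keep" or "merge").
coarsenings : Composition → List Composition
coarsenings []      = [] ∷ []
coarsenings (a ∷ α) = go a α
  where
  go : ℕ → Composition → List Composition
  go c []      = (c ∷ []) ∷ []
  go c (b ∷ γ) = map (c ∷_) (go b γ) ++ go (c + b) γ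

prodFact : Composition → ℕ
prodFact []       = 1
prodFact (b ∷ bs) = b ! * prodFact bs

prodFact≢0 : ∀ β → NonZero (prodFact β)
prodFact≢0 []       = _
prodFact≢0 (b ∷ bs) = m*n≢0 (b !) (prodFact bs) {{b !≢0}} {{prodFact≢0 bs}}

multinomial : Composition → ℕ
multinomial β = ((weight β) ! / prodFact β) {{prodFact≢0 β}}

signPow : ℕ → ℤ
signPow zero    = + 1
signPow (suc k) = - signPow k

sumℤ : List ℤ → ℤ
sumℤ []       = + 0
sumℤ (x ∷ xs) = x ℤ.+ sumℤ xs

-- ∑_{β ⪯ α} (-1)^{ℓ(α)-ℓ(β)} (|β| choose β₁,…,β_{ℓ(β)})
-- (ℓ(β) ≤ ℓ(α) always holds for coarsenings, so truncated subtraction is exact)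
alternatingSum : Composition → ℤ
alternatingSum α =
  sumℤ (map (λ β → signPow (ℓ α Data.Nat.∸ ℓ β) ℤ.* + multinomial β) (coarsenings α))

hypoClassSize : ℕ → Composition → ℤ
hypoClassSize n α = if does (ℓ α ≤? n) then alternatingSum α else + 0

-- Quasi-ribbon tableaux, represented by their list of rows (top to
-- bottom).  The ribbon diagram is determined by the row lengths: the
-- leftmost box of each row sits directly below the rightmost box of the
-- previous row.  Reading the cells "along the ribbon" = concatenating
-- the rows.

Tableau : Set
Tableau = List (List ℕ)

shape : Tableau → Composition
shape = map length

splitRow : ℕ → List ℕ → Maybe (List ℕ × List ℕ)
splitRow a [] = nothing
splitRow a (x ∷ xs) with splitRow a xs
... | just (p , s) = just (x ∷ p , s)
... | nothing      = if does (x ≤? a) then just (x ∷ [] , xs) else nothing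

-- Insertion when some entry is ≤ a: x = last cell with entry ≤ a.
-- The new cell a goes directly right of x; the rest of T (from z, the
-- cell after x) is attached with z directly below the new cell, i.e.
-- starts a new row.  If x is the last cell of T this is "attach a
-- directly right of the last cell".
insertLe : ℕ → Tableau → Maybe Tableau
insertLe a [] = nothing
insertLe a (r ∷ rs) with insertLe a rs
... | just rs' = just (r ∷ rs')
... | nothing with splitRow a r
...   | nothing       = nothing
...   | just (p , []) = just ((p ++ [ a ]) ∷ rs)
...   | just (p , s@(_ ∷ _)) = just ((p ++ [ a ]) ∷ s ∷ rs)

-- Insertion of a into T.  If no entry of T is ≤ a (or T is empty), a new
-- cell a is created with T attached so that its first cell is directly
-- below a (a new top row [a]).
insert : ℕ → Tableau → Tableau
insert a T with insertLe a T
... | just T' = T'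
... | nothing = [ a ] ∷ T

QRℕ : List ℕ → Tableau
QRℕ = foldl (λ T a → insert a T) []

-- The alphabet 𝒜ₙ = {1 < ⋯ < n} is modelled by Fin n, letter i ↦ 1 + toℕ i.
letter : ∀ {n} → Fin n → ℕ
letter i = suc (toℕ i)

QR : ∀ {n} → List (Fin n) → Tableau
QR w = QRℕ (map letter w)

module Submission where

-- Read along the ribbon, a quasi-ribbon tableau is a weakly increasing list of cells,
-- strictly increasing at the cells that start a row; in this flat form inserting a just
-- puts a in front of the first entry greater than a and makes that entry start a row.
-- So QR u = QR w iff the flat forms agree.  If the first row p ends at v and the rest G
-- of the tableau begins at d > v, then a word realises p followed by G, with d starting
-- a row or not, iff its letters ≤ v spell p and its letters > v realise G; whether d
-- starts a row only records whether these two subwords interleave.  Writing N(T) for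
-- the number of words with tableau T and T′ for T with its first two rows merged,
--   N(T) + N(T′) = C(|p| + |G|, |p|) · N(G),
-- which is the recursion of the alternating sum of multinomials in the first part.
-- Row starts strictly increase, so a tableau over 𝒜ₙ has at most n rows.

open import Defs
open import Data.Nat using (ℕ)
open import Data.Fin using (Fin)
open import Data.List using (List; length)
open import Data.List.Membership.Propositional using (_∈_)
open import Data.List.Relation.Unary.Unique.Propositional using (Unique)
open import Data.Product using (Σ; _×_)
open import Data.Integer using (+_)
open import Function.Bundles using (_⇔_)
open import Relation.Binary.PropositionalEquality using (_≡_)

open import Data.Bool using (Bool; true; false; if_then_else_; _∧_; _∨_)
import Data.Bool.Properties as Bool
open import Data.Empty using (⊥)
open import Data.Fin using (toℕ)
open import Data.Fin.Properties using (toℕ-injective; toℕ<n)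
open import Data.Integer using (ℤ)
import Data.Integer as ℤ
import Data.Integer.Properties as ℤₚ
open import Algebra.Properties.CommutativeSemigroup ℤₚ.*-commutativeSemigroup using (x∙yz≈y∙xz)
open import Data.List using ([]; _∷_; _++_; [_]; map; foldl; concat; filter; allFin; cartesianProductWith)
open import Data.List.Properties
  using (map-++; map-∘; map-cong; map-cong-local; ++-assoc; ++-identityʳ; ++-cancelˡ; length-++; length-map;
         ∷-injective; ∷-injectiveˡ; filter-++; ≡-dec)
open import Data.List.Membership.Propositional.Properties
  using (∈-allFin; ∈-map⁺; ∈-filter⁺; ∈-filter⁻; ∈-cartesianProductWith⁺; ∈-cartesianProductWith⁻)
open import Data.List.Relation.Unary.All using (All; []; _∷_)
import Data.List.Relation.Unary.All as All
open import Data.List.Relation.Unary.All.Properties using (++⁺; ++⁻; ++⁻ˡ; ++⁻ʳ; map⁺; concat⁺; concat⁻)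
open import Data.List.Relation.Unary.AllPairs using ([]; _∷_)
open import Data.List.Relation.Unary.Any using (here; there)
import Data.List.Relation.Unary.Unique.Propositional.Properties as Unique
open import Data.Maybe using (just; nothing)
import Data.Nat as ℕ
open import Data.Nat using (zero; suc; _+_; _*_; _∸_; _≤_; _<_; _≤?_; z≤n; s≤s; _!; _/_)
open import Data.Nat.DivMod using (m*n/n≡m)
open import Data.Nat.ListAction using (sum)
open import Data.Nat.Properties
open import Algebra.Properties.CommutativeSemigroup +-commutativeSemigroup
  using () renaming (interchange to +-interchange)
open import Data.Nat.Tactic.RingSolver using (solve-∀)
open import Data.Product using (_,_; proj₁; proj₂; map₁; map₂; map₂′)
open import Data.Product.Properties using () renaming (≡-dec to ×-≡-dec)
open import Data.Sum using (_⊎_; inj₁; inj₂)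
open import Data.Unit using (⊤; tt)
open import Function using (_∘_)
open import Function.Bundles using (mk⇔; Equivalence)
open import Relation.Binary.Definitions using (DecidableEquality)
open import Relation.Binary.PropositionalEquality using (_≢_; refl; sym; trans; cong; cong₂; subst; subst₂; module ≡-Reasoning)
open import Relation.Nullary using (contradiction)
open import Relation.Nullary.Decidable using (Dec; does; yes; no; dec-true; dec-false; does-⇔; _×-dec_; _⊎-dec_)
open import Relation.Unary using (Decidable)

Ascending : ℕ → List ℕ → Set
Ascending x []       = ⊤
Ascending x (y ∷ ys) = x ≤ y × Ascending y ys

lastOf : ℕ → List ℕ → ℕ
lastOf x []       = x
lastOf x (y ∷ ys) = lastOf y ys

Ascending⇒head≤ : ∀ {x} ys → Ascending x ys → All (x ≤_) ys
Ascending⇒head≤ []       _          = []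
Ascending⇒head≤ (y ∷ ys) (x≤y , asc) = x≤y ∷ All.map (≤-trans x≤y) (Ascending⇒head≤ ys asc)

Ascending⇒≤lastOf : ∀ x ys → Ascending x ys → All (_≤ lastOf x ys) (x ∷ ys)
Ascending⇒≤lastOf x []       _           = ≤-refl ∷ []
Ascending⇒≤lastOf x (y ∷ ys) (x≤y , asc) with Ascending⇒≤lastOf y ys asc
... | y≤last ∷ rest = ≤-trans x≤y y≤last ∷ y≤last ∷ rest

Ascending-++ : ∀ x ys y zs → Ascending x ys → lastOf x ys ≤ y → Ascending y zs →
               Ascending x (ys ++ y ∷ zs)
Ascending-++ x []        y zs _           last≤y asc = last≤y , asc
Ascending-++ x (y′ ∷ ys) y zs (x≤y′ , asc) last≤y asc′ = x≤y′ , Ascending-++ y′ ys y zs asc last≤y asc′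

lastOf-All : ∀ {P : ℕ → Set} x ys → All P (x ∷ ys) → P (lastOf x ys)
lastOf-All x []       (px ∷ _) = px
lastOf-All x (y ∷ ys) (_ ∷ ps) = lastOf-All y ys ps

lastOf-++ : ∀ x ys y zs → lastOf x (ys ++ y ∷ zs) ≡ lastOf y zs
lastOf-++ x []        y zs = refl
lastOf-++ x (y′ ∷ ys) y zs = lastOf-++ y′ ys y zs

Step : Bool → ℕ → ℕ → Set
Step false x y = x ≤ y
Step true  x y = x < y

RowsFrom : Bool → ℕ → Tableau → Set
RowsFrom b lo []            = ⊤
RowsFrom b lo ([] ∷ T)      = ⊥
RowsFrom b lo ((d ∷ r) ∷ T) = Step b lo d × Ascending d r × RowsFrom true (lastOf d r) T

NonEmpty : List ℕ → Set
NonEmpty []      = ⊥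
NonEmpty (_ ∷ _) = ⊤

RowsFrom⇒NonEmpty : ∀ {b lo} T → RowsFrom b lo T → All NonEmpty T
RowsFrom⇒NonEmpty []            _              = []
RowsFrom⇒NonEmpty ((d ∷ r) ∷ T) (_ , _ , rows) = tt ∷ RowsFrom⇒NonEmpty T rows

RowsFrom⇒above : ∀ {lo} T → RowsFrom true lo T → All (All (lo <_)) T
RowsFrom⇒above []            _                   = []
RowsFrom⇒above ((d ∷ r) ∷ T) (lo<d , asc , rows) =
  (lo<d ∷ All.map (<-≤-trans lo<d) (Ascending⇒head≤ r asc)) ∷
  All.map (All.map (<-trans (<-≤-trans lo<d d≤last))) (RowsFrom⇒above T rows)
  where d≤last = All.head (Ascending⇒≤lastOf d r asc)

RowsFrom-strict : ∀ {lo} T → RowsFrom false lo T → All (All (lo <_)) T → RowsFrom true lo T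
RowsFrom-strict []            _                _                 = tt
RowsFrom-strict ((d ∷ r) ∷ T) (_ , asc , rows) ((lo<d ∷ _) ∷ _) = lo<d , asc , rows

RowsFrom-length : ∀ {n} lo T → RowsFrom true lo T → All (_≤ n) (concat T) → lo ≤ n → length T + lo ≤ n
RowsFrom-length     lo []            _                   _  lo≤n = lo≤n
RowsFrom-length {n} lo ((d ∷ r) ∷ T) (lo<d , asc , rows) ≤n _    = begin
  suc (length T + lo)     ≡⟨ +-suc (length T) lo ⟨
  length T + suc lo       ≤⟨ +-monoʳ-≤ (length T) (≤-trans lo<d (All.head (Ascending⇒≤lastOf d r asc))) ⟩
  length T + lastOf d r   ≤⟨ RowsFrom-length (lastOf d r) T rows (++⁻ʳ (d ∷ r) ≤n) (lastOf-All d r (++⁻ˡ (d ∷ r) ≤n)) ⟩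
  n                       ∎
  where open ≤-Reasoning

-- Tableaux read along the ribbon

-- The flag of a cell says whether it begins a new row; it is ignored on
-- the first cell.
Cell : Set
Cell = ℕ × Bool

inRow : List ℕ → List Cell
inRow = map (λ x → x , false)

laterRows : Tableau → List Cell
laterRows []            = []
laterRows ([] ∷ T)      = laterRows T
laterRows ((x ∷ r) ∷ T) = (x , true) ∷ inRow r ++ laterRows T

cells : Tableau → List Cell
cells []      = []
cells (r ∷ T) = inRow r ++ laterRows T

toRows     : List Cell → Tableau
currentRow : List Cell → List ℕ × Tableau

currentRow []                = [] , []
currentRow ((x , false) ∷ F) = map₁ (x ∷_) (currentRow F)
currentRow ((x , true)  ∷ F) = [] , toRows ((x , true) ∷ F)

toRows []            = []
toRows ((x , _) ∷ F) = (x ∷ proj₁ (currentRow F)) ∷ proj₂ (currentRow F)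

firstFlag : List Cell → Bool
firstFlag []            = false
firstFlag ((_ , b) ∷ _) = b

withFirstFlag : Bool → List Cell → List Cell
withFirstFlag b []            = []
withFirstFlag b ((x , _) ∷ F) = (x , b) ∷ F

AllValues : (ℕ → Set) → List Cell → Set
AllValues P = All (P ∘ proj₁)

currentRow-cells : ∀ q T → All NonEmpty T → currentRow (inRow q ++ laterRows T) ≡ (q , T)
currentRow-cells (x ∷ q) T ne             = cong (map₁ (x ∷_)) (currentRow-cells q T ne)
currentRow-cells []      []            ne = refl
currentRow-cells []      ((x ∷ r) ∷ T) (_ ∷ ne) =
  cong (λ (r′ , T′) → [] , (x ∷ r′) ∷ T′) (currentRow-cells r T ne)

toRows-cells : ∀ r T → NonEmpty r → All NonEmpty T → toRows (cells (r ∷ T)) ≡ r ∷ T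
toRows-cells (x ∷ r) T _ ne = cong (λ (r′ , T′) → (x ∷ r′) ∷ T′) (currentRow-cells r T ne)

toRows-newRow : ∀ d q x F → toRows (inRow (d ∷ q) ++ (x , true) ∷ F) ≡ (d ∷ q) ∷ toRows ((x , true) ∷ F)
toRows-newRow d q x F = cong (λ (r , T) → (d ∷ r) ∷ T) (currentRow-newRow q)
  where
  currentRow-newRow : ∀ q → currentRow (inRow q ++ (x , true) ∷ F) ≡ (q , toRows ((x , true) ∷ F))
  currentRow-newRow []      = refl
  currentRow-newRow (y ∷ q) = cong (map₁ (y ∷_)) (currentRow-newRow q)

cells-currentRow : ∀ F → inRow (proj₁ (currentRow F)) ++ laterRows (proj₂ (currentRow F)) ≡ F
cells-currentRow []                = refl
cells-currentRow ((x , false) ∷ F) = cong ((x , false) ∷_) (cells-currentRow F)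
cells-currentRow ((x , true)  ∷ F) = cong ((x , true) ∷_) (cells-currentRow F)

cells-toRows : ∀ F → firstFlag F ≡ false → cells (toRows F) ≡ F
cells-toRows []                _    = refl
cells-toRows ((x , .false) ∷ F) refl = cong ((x , false) ∷_) (cells-currentRow F)

concat-toRows : ∀ F → concat (toRows F) ≡ map proj₁ F
concat-toRows []            = refl
concat-toRows ((x , _) ∷ F) = cong (x ∷_) (current F)
  where
  current : ∀ F → proj₁ (currentRow F) ++ concat (proj₂ (currentRow F)) ≡ map proj₁ F
  current []                = refl
  current ((y , false) ∷ F) = cong (y ∷_) (current F)
  current ((y , true)  ∷ F) = cong (y ∷_) (current F)

toRows-injective : ∀ F G → firstFlag F ≡ false → firstFlag G ≡ false → toRows F ≡ toRows G → F ≡ G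
toRows-injective F G fF fG eq =
  trans (sym (cells-toRows F fF)) (trans (cong cells eq) (cells-toRows G fG))

length-cells : ∀ T → length (cells T) ≡ weight (shape T)
length-cells []      = refl
length-cells (r ∷ T) = trans (length-++ (inRow r)) (cong₂ _+_ (length-map _ r) (later T))
  where
  later : ∀ T → length (laterRows T) ≡ weight (shape T)
  later []            = refl
  later ([] ∷ T)      = later T
  later ((x ∷ r) ∷ T) = cong suc (trans (length-++ (inRow r)) (cong₂ _+_ (length-map _ r) (later T)))

cells-AllValues : ∀ {P : ℕ → Set} T → All P (concat T) → AllValues P (cells T)
cells-AllValues []      _  = []
cells-AllValues (r ∷ T) all with ++⁻ r all
... | pr , pT = ++⁺ (map⁺ pr) (later T pT)
  where
  later : ∀ T → All _ (concat T) → AllValues _ (laterRows T)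
  later []            _  = []
  later ([] ∷ T)      pT = later T pT
  later ((x ∷ r) ∷ T) (px ∷ pT) with ++⁻ r pT
  ... | pr , pT′ = px ∷ ++⁺ (map⁺ pr) (later T pT′)

insertCell : ℕ → List Cell → List Cell
insertCell a []            = (a , false) ∷ []
insertCell a ((x , b) ∷ F) with x ≤? a
... | yes _ = (x , b) ∷ insertCell a F
... | no  _ = (a , false) ∷ (x , true) ∷ F

insertAll : List Cell → List ℕ → List Cell
insertAll = foldl (λ F a → insertCell a F)

flatQR : List ℕ → List Cell
flatQR = insertAll []

insertCell-≤ : ∀ {a x} b F → x ≤ a → insertCell a ((x , b) ∷ F) ≡ (x , b) ∷ insertCell a F
insertCell-≤ {a} {x} b F x≤a with x ≤? a
... | yes _   = refl
... | no x≰a = contradiction x≤a x≰a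

insertCell-> : ∀ {a x} b F → a < x → insertCell a ((x , b) ∷ F) ≡ (a , false) ∷ (x , true) ∷ F
insertCell-> {a} {x} b F a<x with x ≤? a
... | yes x≤a = contradiction x≤a (<⇒≱ a<x)
... | no _    = refl

insertCell-skip : ∀ a A X → AllValues (_≤ a) A → insertCell a (A ++ X) ≡ A ++ insertCell a X
insertCell-skip a []            X []          = refl
insertCell-skip a ((x , b) ∷ A) X (x≤a ∷ A≤a) =
  trans (insertCell-≤ b (A ++ X) x≤a) (cong ((x , b) ∷_) (insertCell-skip a A X A≤a))

HeadAbove : ℕ → List Cell → Set
HeadAbove a []            = ⊤
HeadAbove a ((x , _) ∷ _) = a < x

insertCell-front : ∀ a X → HeadAbove a X → insertCell a X ≡ (a , false) ∷ withFirstFlag true X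
insertCell-front a []            _   = refl
insertCell-front a ((x , b) ∷ X) a<x = insertCell-> b X a<x

Ribbon : ℕ → List Cell → Set
Ribbon lo []            = ⊤
Ribbon lo ((x , b) ∷ F) = Step b lo x × Ribbon x F

insertCell-Ribbon : ∀ {lo} a F → lo ≤ a → Ribbon lo F → Ribbon lo (insertCell a F)
insertCell-Ribbon a []            lo≤a _             = lo≤a , tt
insertCell-Ribbon a ((x , b) ∷ F) lo≤a (lo-x , ribbon) with x ≤? a
... | yes x≤a = lo-x , insertCell-Ribbon a F x≤a ribbon
... | no  x≰a = lo≤a , ≰⇒> x≰a , ribbon

insertCell-firstFlag : ∀ a F → firstFlag F ≡ false → firstFlag (insertCell a F) ≡ false
insertCell-firstFlag a []            _  = refl
insertCell-firstFlag a ((x , b) ∷ F) fF with x ≤? a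
... | yes _ = fF
... | no  _ = refl

Ribbon⇒RowsFrom : ∀ {lo} F → Ribbon lo F → RowsFrom (firstFlag F) lo (toRows F)
Ribbon⇒RowsFrom []            _               = tt
Ribbon⇒RowsFrom ((x , b) ∷ F) (lo-x , ribbon) = lo-x , rest F ribbon
  where
  rest : ∀ {x} F → Ribbon x F →
         Ascending x (proj₁ (currentRow F)) × RowsFrom true (lastOf x (proj₁ (currentRow F))) (proj₂ (currentRow F))
  rest []                _                = tt , tt
  rest ((y , false) ∷ F) (x≤y , ribbon)   = map₁ (x≤y ,_) (rest F ribbon)
  rest ((y , true)  ∷ F) (x<y , ribbon)   = tt , x<y , rest F ribbon

-- Row insertion agrees with flat insertion

splitRow-none : ∀ a r → All (a <_) r → splitRow a r ≡ nothing
splitRow-none a []       []          = refl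
splitRow-none a (x ∷ xs) (a<x ∷ a<xs)
  rewrite splitRow-none a xs a<xs | dec-false (x ≤? a) (<⇒≱ a<x) = refl

splitRow-last : ∀ a p x s → x ≤ a → All (a <_) s → splitRow a (p ++ x ∷ s) ≡ just (p ++ [ x ] , s)
splitRow-last a []      x s x≤a a<s rewrite splitRow-none a s a<s | dec-true (x ≤? a) x≤a = refl
splitRow-last a (y ∷ p) x s x≤a a<s rewrite splitRow-last a p x s x≤a a<s = refl

insertLe-none : ∀ a T → All (All (a <_)) T → insertLe a T ≡ nothing
insertLe-none a []      []          = refl
insertLe-none a (r ∷ T) (a<r ∷ a<T) rewrite insertLe-none a T a<T | splitRow-none a r a<r = refl

insertLe-later : ∀ a r T {X} → insertLe a T ≡ just X → insertLe a (r ∷ T) ≡ just (r ∷ X)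
insertLe-later a r T eq rewrite eq = refl

_∷⁺_ : List ℕ → Tableau → Tableau
[]      ∷⁺ T = T
(z ∷ s) ∷⁺ T = (z ∷ s) ∷ T

insertLe-first : ∀ a r T {p s} → insertLe a T ≡ nothing → splitRow a r ≡ just (p , s) →
                 insertLe a (r ∷ T) ≡ just ((p ++ [ a ]) ∷ (s ∷⁺ T))
insertLe-first a r T {s = []}    none split rewrite none | split = refl
insertLe-first a r T {s = _ ∷ _} none split rewrite none | split = refl

splitAscending : ∀ a d q → Ascending d q → d ≤ a →
  Σ (List ℕ) λ p → Σ ℕ λ x → Σ (List ℕ) λ s →
    d ∷ q ≡ p ++ x ∷ s × x ≤ a × All (_≤ a) p × All (a <_) s
splitAscending a d []      _             d≤a = [] , d , [] , refl , d≤a , [] , []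
splitAscending a d (y ∷ q) (d≤y , asc) d≤a with y ≤? a
... | yes y≤a =
  let p , x , s , eq , x≤a , p≤a , a<s = splitAscending a y q asc y≤a
  in  d ∷ p , x , s , cong (d ∷_) eq , x≤a , d≤a ∷ p≤a , a<s
... | no  y≰a =
  [] , d , y ∷ q , refl , d≤a , [] , ≰⇒> y≰a ∷ All.map (<-≤-trans (≰⇒> y≰a)) (Ascending⇒head≤ q asc)

inRow-++-∷ : ∀ p x s L → inRow (p ++ x ∷ s) ++ L ≡ inRow (p ++ [ x ]) ++ inRow s ++ L
inRow-++-∷ []      x s L = refl
inRow-++-∷ (y ∷ p) x s L = cong ((y , false) ∷_) (inRow-++-∷ p x s L)

inRow-++ : ∀ p q L → inRow (p ++ q) ++ L ≡ inRow p ++ inRow q ++ L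
inRow-++ []      q L = refl
inRow-++ (y ∷ p) q L = cong ((y , false) ∷_) (inRow-++ p q L)

NonEmpty-++-∷ : ∀ p {x s} → NonEmpty (p ++ x ∷ s)
NonEmpty-++-∷ []      = tt
NonEmpty-++-∷ (_ ∷ _) = tt

HeadAbove-laterRows : ∀ a T → All (All (a <_)) T → All NonEmpty T → HeadAbove a (laterRows T)
HeadAbove-laterRows a []            _               _ = tt
HeadAbove-laterRows a ((z ∷ _) ∷ _) ((a<z ∷ _) ∷ _) _ = a<z
HeadAbove-laterRows a ([] ∷ _)      _               (() ∷ _)

withFirstFlag-laterRows : ∀ T → All NonEmpty T → withFirstFlag true (laterRows T) ≡ laterRows T
withFirstFlag-laterRows []            _ = refl
withFirstFlag-laterRows ((_ ∷ _) ∷ _) _        = refl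
withFirstFlag-laterRows ([] ∷ _)      (() ∷ _)

insertLe-split : ∀ a p x s T → x ≤ a → All (_≤ a) p → All (a <_) s →
  All (All (a <_)) T → All NonEmpty T →
  insertLe a ((p ++ x ∷ s) ∷ T) ≡ just (toRows (insertCell a (cells ((p ++ x ∷ s) ∷ T))))
insertLe-split a p x s T x≤a p≤a a<s a<T ne =
  trans (insertLe-first a (p ++ x ∷ s) T (insertLe-none a T a<T) (splitRow-last a p x s x≤a a<s))
        (cong just (sym flat))
  where
  open ≡-Reasoning
  headAbove : ∀ s → All (a <_) s → HeadAbove a (inRow s ++ laterRows T)
  headAbove (z ∷ s) (a<z ∷ _) = a<z
  headAbove []      _         = HeadAbove-laterRows a T a<T ne
  flagged : ∀ s → withFirstFlag true (inRow s ++ laterRows T) ≡ laterRows (s ∷⁺ T)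
  flagged (z ∷ s) = refl
  flagged []      = withFirstFlag-laterRows T ne
  nonEmpty : ∀ s → All NonEmpty (s ∷⁺ T)
  nonEmpty []      = ne
  nonEmpty (_ ∷ _) = tt ∷ ne
  px≤a : AllValues (_≤ a) (inRow (p ++ [ x ]))
  px≤a = map⁺ (++⁺ p≤a (x≤a ∷ []))
  flat : toRows (insertCell a (cells ((p ++ x ∷ s) ∷ T))) ≡ ((p ++ [ x ]) ++ [ a ]) ∷ (s ∷⁺ T)
  flat = begin
    toRows (insertCell a (inRow (p ++ x ∷ s) ++ laterRows T))
      ≡⟨ cong (toRows ∘ insertCell a) (inRow-++-∷ p x s (laterRows T)) ⟩
    toRows (insertCell a (inRow (p ++ [ x ]) ++ inRow s ++ laterRows T))
      ≡⟨ cong toRows (insertCell-skip a (inRow (p ++ [ x ])) _ px≤a) ⟩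
    toRows (inRow (p ++ [ x ]) ++ insertCell a (inRow s ++ laterRows T))
      ≡⟨ cong (λ F → toRows (inRow (p ++ [ x ]) ++ F)) (insertCell-front a _ (headAbove s a<s)) ⟩
    toRows (inRow (p ++ [ x ]) ++ (a , false) ∷ withFirstFlag true (inRow s ++ laterRows T))
      ≡⟨ cong (λ F → toRows (inRow (p ++ [ x ]) ++ (a , false) ∷ F)) (flagged s) ⟩
    toRows (inRow (p ++ [ x ]) ++ (a , false) ∷ laterRows (s ∷⁺ T))
      ≡⟨ cong toRows (inRow-++ (p ++ [ x ]) [ a ] (laterRows (s ∷⁺ T))) ⟨
    toRows (cells (((p ++ [ x ]) ++ [ a ]) ∷ (s ∷⁺ T)))
      ≡⟨ toRows-cells ((p ++ [ x ]) ++ [ a ]) (s ∷⁺ T) (NonEmpty-++-∷ (p ++ [ x ])) (nonEmpty s) ⟩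
    ((p ++ [ x ]) ++ [ a ]) ∷ (s ∷⁺ T) ∎

insertLe-within : ∀ a d q T → Ascending d q → d ≤ a → All (All (a <_)) T → All NonEmpty T →
  insertLe a ((d ∷ q) ∷ T) ≡ just (toRows (insertCell a (cells ((d ∷ q) ∷ T))))
insertLe-within a d q T asc d≤a a<T ne =
  let p , x , s , row≡ , x≤a , p≤a , a<s = splitAscending a d q asc d≤a
  in  subst (λ r → insertLe a (r ∷ T) ≡ just (toRows (insertCell a (cells (r ∷ T)))))
            (sym row≡) (insertLe-split a p x s T x≤a p≤a a<s a<T ne)

insertLe-flat : ∀ a d q T → Ascending d q → RowsFrom true (lastOf d q) T → d ≤ a →
  insertLe a ((d ∷ q) ∷ T) ≡ just (toRows (insertCell a (cells ((d ∷ q) ∷ T))))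
insertLe-flat a d q [] asc _ d≤a = insertLe-within a d q [] asc d≤a [] []
insertLe-flat a d q ((d′ ∷ q′) ∷ T) asc (last<d′ , asc′ , rows) d≤a with d′ ≤? a
... | no d′≰a =
  insertLe-within a d q ((d′ ∷ q′) ∷ T) asc d≤a
    (RowsFrom⇒above ((d′ ∷ q′) ∷ T) (≰⇒> d′≰a , asc′ , rows))
    (tt ∷ RowsFrom⇒NonEmpty T rows)
... | yes d′≤a =
  trans (insertLe-later a (d ∷ q) ((d′ ∷ q′) ∷ T) (insertLe-flat a d′ q′ T asc′ rows d′≤a)) (cong just later)
  where
  open ≡-Reasoning
  Y = inRow q′ ++ laterRows T
  dq≤a : AllValues (_≤ a) (inRow (d ∷ q))
  dq≤a = map⁺ (All.map (λ z → ≤-trans z (≤-trans (<⇒≤ last<d′) d′≤a)) (Ascending⇒≤lastOf d q asc))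
  later : (d ∷ q) ∷ toRows (insertCell a ((d′ , false) ∷ Y))
        ≡ toRows (insertCell a (inRow (d ∷ q) ++ (d′ , true) ∷ Y))
  later = begin
    (d ∷ q) ∷ toRows (insertCell a ((d′ , false) ∷ Y))
      ≡⟨ cong (λ F → (d ∷ q) ∷ toRows F) (insertCell-≤ false Y d′≤a) ⟩
    (d ∷ q) ∷ toRows ((d′ , true) ∷ insertCell a Y)
      ≡⟨ toRows-newRow d q d′ (insertCell a Y) ⟨
    toRows (inRow (d ∷ q) ++ (d′ , true) ∷ insertCell a Y)
      ≡⟨ cong (λ F → toRows (inRow (d ∷ q) ++ F)) (insertCell-≤ true Y d′≤a) ⟨
    toRows (inRow (d ∷ q) ++ insertCell a ((d′ , true) ∷ Y))
      ≡⟨ cong toRows (insertCell-skip a (inRow (d ∷ q)) _ dq≤a) ⟨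
    toRows (insertCell a (inRow (d ∷ q) ++ (d′ , true) ∷ Y)) ∎

insert-flat : ∀ {b lo} a T → RowsFrom b lo T → insert a T ≡ toRows (insertCell a (cells T))
insert-flat a []            _              = refl
insert-flat a ((d ∷ q) ∷ T) (_ , asc , rows) = byCases (d ≤? a)
  where
  byCases : Dec (d ≤ a) → insert a ((d ∷ q) ∷ T) ≡ toRows (insertCell a (cells ((d ∷ q) ∷ T)))
  byCases (yes d≤a) rewrite insertLe-flat a d q T asc rows d≤a = refl
  byCases (no  d≰a)
    rewrite insertLe-none a ((d ∷ q) ∷ T)
              (RowsFrom⇒above ((d ∷ q) ∷ T) (≰⇒> d≰a , asc , rows))
          | insertCell-> false (inRow q ++ laterRows T) (≰⇒> d≰a)
    = cong ((a ∷ []) ∷_) (sym (toRows-cells (d ∷ q) T tt (RowsFrom⇒NonEmpty T rows)))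

insertAll-toRows : ∀ F u → Ribbon 0 F → firstFlag F ≡ false →
  foldl (λ T a → insert a T) (toRows F) u ≡ toRows (insertAll F u)
insertAll-toRows F []      _      _  = refl
insertAll-toRows F (a ∷ u) ribbon fF
  rewrite insert-flat a (toRows F) (Ribbon⇒RowsFrom F ribbon) | cells-toRows F fF =
  insertAll-toRows (insertCell a F) u (insertCell-Ribbon a F z≤n ribbon) (insertCell-firstFlag a F fF)

QRℕ≡toRows-flatQR : ∀ u → QRℕ u ≡ toRows (flatQR u)
QRℕ≡toRows-flatQR u = insertAll-toRows [] u tt refl

length-insertCell : ∀ a F → length (insertCell a F) ≡ suc (length F)
length-insertCell a []            = refl
length-insertCell a ((x , b) ∷ F) with x ≤? a
... | yes _ = cong suc (length-insertCell a F)
... | no  _ = refl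

length-insertAll : ∀ F u → length (insertAll F u) ≡ length F + length u
length-insertAll F []      = sym (+-identityʳ _)
length-insertAll F (a ∷ u) = begin
  length (insertAll (insertCell a F) u) ≡⟨ length-insertAll (insertCell a F) u ⟩
  length (insertCell a F) + length u    ≡⟨ cong (_+ length u) (length-insertCell a F) ⟩
  suc (length F) + length u             ≡⟨ +-suc (length F) (length u) ⟨
  length F + length (a ∷ u)             ∎
  where open ≡-Reasoning

length-flatQR : ∀ u → length (flatQR u) ≡ length u
length-flatQR = length-insertAll []

module _ {P : ℕ → Set} where

  insertCell-AllValues : ∀ a F → P a → AllValues P F → AllValues P (insertCell a F)
  insertCell-AllValues a []            pa _          = pa ∷ []
  insertCell-AllValues a ((x , b) ∷ F) pa (px ∷ pF) with x ≤? a
  ... | yes _ = px ∷ insertCell-AllValues a F pa pF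
  ... | no  _ = pa ∷ px ∷ pF

  insertCell-AllValues⁻ : ∀ a F → AllValues P (insertCell a F) → P a × AllValues P F
  insertCell-AllValues⁻ a []            (pa ∷ []) = pa , []
  insertCell-AllValues⁻ a ((x , b) ∷ F) all with x ≤? a | all
  ... | yes _ | px ∷ pF′     = map₂′ (px ∷_) (insertCell-AllValues⁻ a F pF′)
  ... | no  _ | pa ∷ px ∷ pF = pa , px ∷ pF

  insertAll-AllValues : ∀ F u → AllValues P F → All P u → AllValues P (insertAll F u)
  insertAll-AllValues F []      pF _          = pF
  insertAll-AllValues F (a ∷ u) pF (pa ∷ pu) =
    insertAll-AllValues (insertCell a F) u (insertCell-AllValues a F pa pF) pu

  insertAll-AllValues⁻ : ∀ F u → AllValues P (insertAll F u) → AllValues P F × All P u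
  insertAll-AllValues⁻ F []      pF = pF , []
  insertAll-AllValues⁻ F (a ∷ u) all =
    let pF′ , pu = insertAll-AllValues⁻ (insertCell a F) u all
        pa  , pF = insertCell-AllValues⁻ a F pF′
    in  pF , pa ∷ pu

  flatQR-AllValues : ∀ u → All P u → AllValues P (flatQR u)
  flatQR-AllValues u = insertAll-AllValues [] u []

  flatQR-AllValues⁻ : ∀ u → AllValues P (flatQR u) → All P u
  flatQR-AllValues⁻ u = proj₂ ∘ insertAll-AllValues⁻ [] u

insertAll-Ribbon : ∀ F u → Ribbon 0 F → Ribbon 0 (insertAll F u)
insertAll-Ribbon F []      ribbon = ribbon
insertAll-Ribbon F (a ∷ u) ribbon = insertAll-Ribbon (insertCell a F) u (insertCell-Ribbon a F z≤n ribbon)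

insertAll-firstFlag : ∀ F u → firstFlag F ≡ false → firstFlag (insertAll F u) ≡ false
insertAll-firstFlag F []      fF = fF
insertAll-firstFlag F (a ∷ u) fF = insertAll-firstFlag (insertCell a F) u (insertCell-firstFlag a F fF)

flatQR-firstFlag : ∀ u → firstFlag (flatQR u) ≡ false
flatQR-firstFlag u = insertAll-firstFlag [] u refl

insertAll-ascending : ∀ F x q → AllValues (_≤ x) F → Ascending x q → insertAll F q ≡ F ++ inRow q
insertAll-ascending F x []      _   _            = sym (++-identityʳ F)
insertAll-ascending F x (y ∷ q) F≤x (x≤y , asc) = begin
  insertAll (insertCell y F) q              ≡⟨ cong (λ G → insertAll G q) end ⟩
  insertAll (F ++ (y , false) ∷ []) q       ≡⟨ insertAll-ascending (F ++ (y , false) ∷ []) y q F≤y asc ⟩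
  (F ++ (y , false) ∷ []) ++ inRow q        ≡⟨ ++-assoc F _ (inRow q) ⟩
  F ++ inRow (y ∷ q)                        ∎
  where
  open ≡-Reasoning
  F≤y′ : AllValues (_≤ y) F
  F≤y′ = All.map (λ z → ≤-trans z x≤y) F≤x
  F≤y : AllValues (_≤ y) (F ++ (y , false) ∷ [])
  F≤y = ++⁺ F≤y′ (≤-refl ∷ [])
  end : insertCell y F ≡ F ++ (y , false) ∷ []
  end = trans (cong (insertCell y) (sym (++-identityʳ F))) (insertCell-skip y F [] F≤y′)

flatQR-ascending : ∀ d q → Ascending d q → flatQR (d ∷ q) ≡ inRow (d ∷ q)
flatQR-ascending d q asc = insertAll-ascending [] d (d ∷ q) [] (≤-refl , asc)

insertCell-inRow⁻ : ∀ a X p → insertCell a X ≡ inRow p → Σ (List ℕ) λ p₀ → X ≡ inRow p₀ × p ≡ p₀ ++ [ a ]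
insertCell-inRow⁻ a [] (_ ∷ []) refl = [] , refl , refl
insertCell-inRow⁻ a ((x , b) ∷ X) p eq with x ≤? a | p | eq
... | yes _ | z ∷ p′ | eq′ with ∷-injective eq′
...   | refl , eq″ =
  let p₀ , X≡ , p′≡ = insertCell-inRow⁻ a X p′ eq″
  in  x ∷ p₀ , cong ((x , false) ∷_) X≡ , cong (x ∷_) p′≡
insertCell-inRow⁻ a ((x , b) ∷ X) p eq | no _ | _ ∷ _ ∷ _ | ()

insertAll-inRow⁻ : ∀ X y p → insertAll X y ≡ inRow p → Σ (List ℕ) λ p₀ → X ≡ inRow p₀ × p ≡ p₀ ++ y
insertAll-inRow⁻ X []      p eq = p , eq , sym (++-identityʳ p)
insertAll-inRow⁻ X (a ∷ y) p eq =
  let p₁ , X′≡ , p≡  = insertAll-inRow⁻ (insertCell a X) y p eq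
      p₀ , X≡  , p₁≡ = insertCell-inRow⁻ a X p₁ X′≡
  in  p₀ , X≡ , trans p≡ (trans (cong (_++ y) p₁≡) (++-assoc p₀ [ a ] y))

flatQR-inRow⁻ : ∀ y p → flatQR y ≡ inRow p → y ≡ p
flatQR-inRow⁻ y p eq with insertAll-inRow⁻ [] y p eq
... | [] , _ , p≡ = sym p≡

-- Splitting a word at a threshold

low high : ℕ → List ℕ → List ℕ
low v []      = []
low v (a ∷ y) with a ≤? v
... | yes _ = a ∷ low v y
... | no  _ = low v y
high v []      = []
high v (a ∷ y) with a ≤? v
... | yes _ = high v y
... | no  _ = a ∷ high v y

low-≤ : ∀ v y → All (_≤ v) (low v y)
low-≤ v []      = []
low-≤ v (a ∷ y) with a ≤? v
... | yes a≤v = a≤v ∷ low-≤ v y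
... | no  _   = low-≤ v y

high-> : ∀ v y → All (v <_) (high v y)
high-> v []      = []
high-> v (a ∷ y) with a ≤? v
... | yes _   = high-> v y
... | no  a≰v = ≰⇒> a≰v ∷ high-> v y

low-none : ∀ v y → All (v <_) y → low v y ≡ []
low-none v []      []          = refl
low-none v (a ∷ y) (v<a ∷ v<y) with a ≤? v
... | yes a≤v = contradiction a≤v (<⇒≱ v<a)
... | no  _   = low-none v y v<y

high-all : ∀ v y → All (v <_) y → high v y ≡ y
high-all v []      []          = refl
high-all v (a ∷ y) (v<a ∷ v<y) with a ≤? v
... | yes a≤v = contradiction a≤v (<⇒≱ v<a)
... | no  _   = cong (a ∷_) (high-all v y v<y)

low-none⁻ : ∀ v y → low v y ≡ [] → All (v <_) y
low-none⁻ v []      _  = []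
low-none⁻ v (a ∷ y) eq with a ≤? v
... | no a≰v = ≰⇒> a≰v ∷ low-none⁻ v y eq

length-low : ∀ v y → length (low v y) ≤ length y
length-low v []      = z≤n
length-low v (a ∷ y) with a ≤? v
... | yes _ = s≤s (length-low v y)
... | no  _ = m≤n⇒m≤1+n (length-low v y)

private
  insertCell-low : ∀ v a L H b₀ → a ≤ v → AllValues (v <_) H →
    Σ Bool λ b₁ → insertCell a (L ++ withFirstFlag b₀ H) ≡ insertCell a L ++ withFirstFlag b₁ H
  insertCell-low v a [] [] b₀ _ _ = false , refl
  insertCell-low v a [] ((x , _) ∷ H) b₀ a≤v (v<x ∷ _) = true , insertCell-> b₀ H (≤-<-trans a≤v v<x)
  insertCell-low v a ((x , g) ∷ L) H b₀ a≤v v<H with x ≤? a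
  ... | yes _ = map₂ (cong ((x , g) ∷_)) (insertCell-low v a L H b₀ a≤v v<H)
  ... | no  _ = b₀ , refl

  insertCell-high : ∀ a H b₀ → Σ Bool λ b₁ → insertCell a (withFirstFlag b₀ H) ≡ withFirstFlag b₁ (insertCell a H)
  insertCell-high a []            b₀ = false , refl
  insertCell-high a ((x , g) ∷ H) b₀ with x ≤? a
  ... | yes _ = b₀ , refl
  ... | no  _ = false , refl

insertAll-split : ∀ v y L H b₀ → AllValues (_≤ v) L → AllValues (v <_) H →
  Σ Bool λ b₁ → insertAll (L ++ withFirstFlag b₀ H) y
              ≡ insertAll L (low v y) ++ withFirstFlag b₁ (insertAll H (high v y))
insertAll-split v []      L H b₀ _   _   = b₀ , refl
insertAll-split v (a ∷ y) L H b₀ L≤v v<H with a ≤? v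
... | yes a≤v with insertCell-low v a L H b₀ a≤v v<H
...   | b₁ , eq rewrite eq =
  insertAll-split v y (insertCell a L) H b₁ (insertCell-AllValues a L a≤v L≤v) v<H
insertAll-split v (a ∷ y) L H b₀ L≤v v<H | no a≰v with insertCell-high a H b₀
...   | b₁ , eq
  rewrite insertCell-skip a L (withFirstFlag b₀ H) (All.map (λ z → ≤-trans z (<⇒≤ (≰⇒> a≰v))) L≤v) | eq =
  insertAll-split v y L (insertCell a H) b₁ L≤v (insertCell-AllValues a H (≰⇒> a≰v) v<H)

flatQR-split : ∀ v y → Σ Bool λ b → flatQR y ≡ flatQR (low v y) ++ withFirstFlag b (flatQR (high v y))
flatQR-split v y = insertAll-split v y [] [] false [] []

++-split-unique : ∀ v X Y X′ Y′ → AllValues (_≤ v) X → AllValues (_≤ v) X′ →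
  HeadAbove v Y → HeadAbove v Y′ → X ++ Y ≡ X′ ++ Y′ → X ≡ X′ × Y ≡ Y′
++-split-unique v [] Y [] Y′ _ _ _ _ eq = refl , eq
++-split-unique v [] ((y , _) ∷ Y) ((x , _) ∷ X′) Y′ _ (x≤v ∷ _) v<y _ refl = contradiction x≤v (<⇒≱ v<y)
++-split-unique v ((x , _) ∷ X) Y [] ((y , _) ∷ Y′) (x≤v ∷ _) _ _ v<y refl = contradiction x≤v (<⇒≱ v<y)
++-split-unique v (c ∷ X) Y (c′ ∷ X′) Y′ (_ ∷ X≤v) (_ ∷ X′≤v) hY hY′ eq
  with refl , eq′ ← ∷-injective eq =
  map₁ (cong (c ∷_)) (++-split-unique v X Y X′ Y′ X≤v X′≤v hY hY′ eq′)

_≟ʷ_ : DecidableEquality (List ℕ)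
_≟ʷ_ = ≡-dec ℕ._≟_

_≟ᶜ_ : DecidableEquality (List Cell)
_≟ᶜ_ = ≡-dec (×-≡-dec ℕ._≟_ Bool._≟_)

AllValues⇒HeadAbove : ∀ {v} b F → AllValues (v <_) F → HeadAbove v (withFirstFlag b F)
AllValues⇒HeadAbove b []            _         = tt
AllValues⇒HeadAbove b ((x , _) ∷ F) (v<x ∷ _) = v<x

withFirstFlag⁻ : ∀ {b x b′ R} F → firstFlag F ≡ false → withFirstFlag b F ≡ (x , b′) ∷ R → F ≡ (x , false) ∷ R
withFirstFlag⁻ ((y , .false) ∷ F) refl eq with refl , refl ← ∷-injective eq = refl

flatQR-break⇔ : ∀ v d₁ q₁ d R y → Ascending d₁ q₁ → All (_≤ v) (d₁ ∷ q₁) → v < d →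
  (low v y ≡ d₁ ∷ q₁ × flatQR (high v y) ≡ (d , false) ∷ R)
  ⇔ (flatQR y ≡ inRow (d₁ ∷ q₁) ++ (d , true) ∷ R ⊎ flatQR y ≡ inRow (d₁ ∷ q₁) ++ (d , false) ∷ R)
flatQR-break⇔ v d₁ q₁ d R y asc p≤v v<d =
  mk⇔ recompose (λ { (inj₁ eq) → decompose eq ; (inj₂ eq) → decompose eq })
  where
  p = d₁ ∷ q₁
  decompose : ∀ {b′} → flatQR y ≡ inRow p ++ (d , b′) ∷ R → low v y ≡ p × flatQR (high v y) ≡ (d , false) ∷ R
  decompose eq with flatQR-split v y
  ... | b , split =
    let low≡ , high≡ = ++-split-unique v _ _ _ _
                          (flatQR-AllValues (low v y) (low-≤ v y)) (map⁺ p≤v)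
                          (AllValues⇒HeadAbove b _ (flatQR-AllValues (high v y) (high-> v y))) v<d
                          (trans (sym split) eq)
    in  flatQR-inRow⁻ (low v y) p low≡ , withFirstFlag⁻ _ (flatQR-firstFlag (high v y)) high≡
  flat-low : low v y ≡ p → flatQR (low v y) ≡ inRow p
  flat-low low≡ = trans (cong flatQR low≡) (flatQR-ascending d₁ q₁ asc)
  recompose : low v y ≡ p × flatQR (high v y) ≡ (d , false) ∷ R →
              flatQR y ≡ inRow p ++ (d , true) ∷ R ⊎ flatQR y ≡ inRow p ++ (d , false) ∷ R
  recompose (low≡ , high≡) with flatQR-split v y
  ... | true  , eq = inj₁ (trans eq (cong₂ (λ L H → L ++ withFirstFlag true H) (flat-low low≡) high≡))
  ... | false , eq = inj₂ (trans eq (cong₂ (λ L H → L ++ withFirstFlag false H) (flat-low low≡) high≡))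

-- Multinomial coefficients

-- shuffles a b = C(a + b, a), by Pascal's rule.
shuffles : ℕ → ℕ → ℕ
shuffles zero    _       = 1
shuffles (suc a) zero    = 1
shuffles (suc a) (suc b) = shuffles a (suc b) + shuffles (suc a) b

shuffles-zeroʳ : ∀ a → shuffles a 0 ≡ 1
shuffles-zeroʳ zero    = refl
shuffles-zeroʳ (suc a) = refl

shuffles-! : ∀ a b → shuffles a b * (a ! * b !) ≡ (a + b) !
shuffles-! zero    b    = trans (*-identityˡ _) (*-identityˡ _)
shuffles-! (suc a) zero = trans (*-identityˡ _) (trans (*-identityʳ _) (cong _! (sym (+-identityʳ (suc a)))))
shuffles-! (suc a) (suc b) = begin
  (shuffles a (suc b) + shuffles (suc a) b) * (suc a ! * suc b !)
    ≡⟨ distribute (shuffles a (suc b)) (shuffles (suc a) b) a b (a !) (b !) ⟩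
  suc a * (shuffles a (suc b) * (a ! * suc b !)) + suc b * (shuffles (suc a) b * (suc a ! * b !))
    ≡⟨ cong₂ (λ x y → suc a * x + suc b * y) (shuffles-! a (suc b)) (shuffles-! (suc a) b) ⟩
  suc a * (a + suc b) ! + suc b * (suc a + b) !
    ≡⟨ cong (λ n → suc a * n ! + suc b * (suc a + b) !) (+-suc a b) ⟩
  suc a * (suc a + b) ! + suc b * (suc a + b) !
    ≡⟨ *-distribʳ-+ ((suc a + b) !) (suc a) (suc b) ⟨
  (suc a + suc b) * (suc a + b) !
    ≡⟨ cong (λ n → (suc a + suc b) * n !) (+-suc a b) ⟨
  (suc a + suc b) ! ∎
  where
  open ≡-Reasoning
  distribute : ∀ x y a b m n → (x + y) * ((suc a * m) * (suc b * n))
             ≡ suc a * (x * (m * (suc b * n))) + suc b * (y * ((suc a * m) * n))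
  distribute = solve-∀

private
  regroup : ∀ s f m p → s * (f * (m * p)) ≡ (s * m) * (f * p)
  regroup = solve-∀

-- multinomial is defined by ℕ division; the second fact says that it is exact, and
-- the two are proved together.
multinomial-∷ : ∀ c β → multinomial (c ∷ β) ≡ shuffles c (weight β) * multinomial β
multinomial-*-prodFact : ∀ β → multinomial β * prodFact β ≡ weight β !

multinomial-∷ c β =
  trans (cong (λ n → (n / (c ! * prodFact β)) {{prodFact≢0 (c ∷ β)}}) factored)
        (m*n/n≡m (shuffles c (weight β) * multinomial β) (c ! * prodFact β) {{prodFact≢0 (c ∷ β)}})
  where
  open ≡-Reasoning
  factored : (c + weight β) ! ≡ (shuffles c (weight β) * multinomial β) * (c ! * prodFact β)
  factored = begin
    (c + weight β) !
      ≡⟨ shuffles-! c (weight β) ⟨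
    shuffles c (weight β) * (c ! * weight β !)
      ≡⟨ cong (λ n → shuffles c (weight β) * (c ! * n)) (multinomial-*-prodFact β) ⟨
    shuffles c (weight β) * (c ! * (multinomial β * prodFact β))
      ≡⟨ regroup (shuffles c (weight β)) (c !) (multinomial β) (prodFact β) ⟩
    (shuffles c (weight β) * multinomial β) * (c ! * prodFact β) ∎

multinomial-*-prodFact []      = refl
multinomial-*-prodFact (c ∷ β) = begin
  multinomial (c ∷ β) * (c ! * prodFact β)
    ≡⟨ cong (_* (c ! * prodFact β)) (multinomial-∷ c β) ⟩
  (shuffles c (weight β) * multinomial β) * (c ! * prodFact β)
    ≡⟨ regroup (shuffles c (weight β)) (c !) (multinomial β) (prodFact β) ⟨
  shuffles c (weight β) * (c ! * (multinomial β * prodFact β))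
    ≡⟨ cong (λ n → shuffles c (weight β) * (c ! * n)) (multinomial-*-prodFact β) ⟩
  shuffles c (weight β) * (c ! * weight β !)
    ≡⟨ shuffles-! c (weight β) ⟩
  (c + weight β) ! ∎
  where open ≡-Reasoning

sumℤ-++ : ∀ xs ys → sumℤ (xs ++ ys) ≡ sumℤ xs ℤ.+ sumℤ ys
sumℤ-++ []       ys = sym (ℤₚ.+-identityˡ _)
sumℤ-++ (x ∷ xs) ys = trans (cong (ℤ._+_ x) (sumℤ-++ xs ys)) (sym (ℤₚ.+-assoc x (sumℤ xs) (sumℤ ys)))

sumℤ-map-*ˡ : ∀ {X : Set} (xs : List X) c f → sumℤ (map (λ x → c ℤ.* f x) xs) ≡ c ℤ.* sumℤ (map f xs)
sumℤ-map-*ˡ []       c f = sym (ℤₚ.*-zeroʳ c)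
sumℤ-map-*ˡ (x ∷ xs) c f =
  trans (cong (ℤ._+_ (c ℤ.* f x)) (sumℤ-map-*ˡ xs c f)) (sym (ℤₚ.*-distribˡ-+ c (f x) _))

sumℤ-map-neg : ∀ {X : Set} (xs : List X) f → sumℤ (map (λ x → ℤ.- f x) xs) ≡ ℤ.- sumℤ (map f xs)
sumℤ-map-neg []       f = refl
sumℤ-map-neg (x ∷ xs) f =
  trans (cong (ℤ._+_ (ℤ.- f x)) (sumℤ-map-neg xs f)) (sym (ℤₚ.neg-distrib-+ (f x) _))

coarsenings-∷ : ∀ c γ →
  All (λ β → weight β ≡ c + weight γ × length β ≤ suc (length γ)) (coarsenings (c ∷ γ))
coarsenings-∷ c []      = (refl , ≤-refl) ∷ []
coarsenings-∷ c (b ∷ γ) =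
  ++⁺ (map⁺ (All.map (λ (w≡ , ℓ≤) → cong (_+_ c) w≡ , s≤s ℓ≤) (coarsenings-∷ b γ)))
      (All.map (λ (w≡ , ℓ≤) → trans w≡ (+-assoc c b (weight γ)) , m≤n⇒m≤1+n ℓ≤) (coarsenings-∷ (c + b) γ))

term : Composition → Composition → ℤ
term α β = signPow (length α ∸ length β) ℤ.* + multinomial β

-- Coarsenings of c ∷ b ∷ γ either keep the first part c, or merge it with b.
alternatingSum-∷∷ : ∀ c b γ → alternatingSum (c ∷ b ∷ γ)
  ≡ + shuffles c (b + weight γ) ℤ.* alternatingSum (b ∷ γ) ℤ.- alternatingSum ((c + b) ∷ γ)
alternatingSum-∷∷ c b γ = begin
  sumℤ (map (term α) (map (c ∷_) (coarsenings (b ∷ γ)) ++ coarsenings ((c + b) ∷ γ)))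
    ≡⟨ cong sumℤ (map-++ (term α) (map (c ∷_) (coarsenings (b ∷ γ))) _) ⟩
  sumℤ (map (term α) (map (c ∷_) (coarsenings (b ∷ γ))) ++ map (term α) (coarsenings ((c + b) ∷ γ)))
    ≡⟨ sumℤ-++ (map (term α) (map (c ∷_) (coarsenings (b ∷ γ)))) _ ⟩
  sumℤ (map (term α) (map (c ∷_) (coarsenings (b ∷ γ)))) ℤ.+ sumℤ (map (term α) (coarsenings ((c + b) ∷ γ)))
    ≡⟨ cong₂ ℤ._+_ kept merged ⟩
  + shuffles c W ℤ.* alternatingSum (b ∷ γ) ℤ.- alternatingSum ((c + b) ∷ γ) ∎
  where
  open ≡-Reasoning
  α = c ∷ b ∷ γ
  W = b + weight γ
  kept : sumℤ (map (term α) (map (c ∷_) (coarsenings (b ∷ γ)))) ≡ + shuffles c W ℤ.* alternatingSum (b ∷ γ)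
  kept = begin
    sumℤ (map (term α) (map (c ∷_) (coarsenings (b ∷ γ))))
      ≡⟨ cong sumℤ (map-∘ (coarsenings (b ∷ γ))) ⟨
    sumℤ (map (term α ∘ (c ∷_)) (coarsenings (b ∷ γ)))
      ≡⟨ cong sumℤ (map-cong-local (All.map (λ {β} (w≡ , _) → scaled β w≡) (coarsenings-∷ b γ))) ⟩
    sumℤ (map (λ β → + shuffles c W ℤ.* term (b ∷ γ) β) (coarsenings (b ∷ γ)))
      ≡⟨ sumℤ-map-*ˡ (coarsenings (b ∷ γ)) (+ shuffles c W) (term (b ∷ γ)) ⟩
    + shuffles c W ℤ.* alternatingSum (b ∷ γ) ∎
    where
    scaled : ∀ β → weight β ≡ W → term α (c ∷ β) ≡ + shuffles c W ℤ.* term (b ∷ γ) β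
    scaled β w≡ = begin
      σ ℤ.* + multinomial (c ∷ β)
        ≡⟨ cong (λ m → σ ℤ.* + m) (trans (multinomial-∷ c β) (cong (λ w → shuffles c w * multinomial β) w≡)) ⟩
      σ ℤ.* + (shuffles c W * multinomial β)
        ≡⟨ cong (σ ℤ.*_) (ℤₚ.pos-* (shuffles c W) (multinomial β)) ⟩
      σ ℤ.* (+ shuffles c W ℤ.* + multinomial β)
        ≡⟨ x∙yz≈y∙xz σ (+ shuffles c W) (+ multinomial β) ⟩
      + shuffles c W ℤ.* term (b ∷ γ) β ∎
      where σ = signPow (length (b ∷ γ) ∸ length β)
  merged : sumℤ (map (term α) (coarsenings ((c + b) ∷ γ))) ≡ ℤ.- alternatingSum ((c + b) ∷ γ)
  merged = trans (cong sumℤ (map-cong-local (All.map (λ {β} (_ , ℓ≤) → flipped β ℓ≤) (coarsenings-∷ (c + b) γ))))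
                 (sumℤ-map-neg (coarsenings ((c + b) ∷ γ)) (term ((c + b) ∷ γ)))
    where
    flipped : ∀ β → length β ≤ suc (length γ) → term α β ≡ ℤ.- term ((c + b) ∷ γ) β
    flipped β ℓ≤ rewrite +-∸-assoc 1 ℓ≤ = sym (ℤₚ.neg-distribˡ-* (signPow (suc (length γ) ∸ length β)) _)

alternatingSum-singleton : ∀ c → alternatingSum (c ∷ []) ≡ + 1
alternatingSum-singleton c =
  cong (λ m → + 1 ℤ.* + m ℤ.+ + 0) (trans (multinomial-∷ c []) (trans (*-identityʳ _) (shuffles-zeroʳ c)))

m+n≡o⇒m≡o-n : ∀ {m n o} → m + n ≡ o → + m ≡ + o ℤ.- + n
m+n≡o⇒m≡o-n {m} {n} refl =
  sym (trans (ℤₚ.m-n≡m⊖n (m + n) n) (trans (ℤₚ.⊖-≥ (m≤n+m n m)) (cong +_ (m+n∸n≡m m n))))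

-- Counting words

sum-map-+ : ∀ {X : Set} (xs : List X) f g → sum (map (λ a → f a + g a) xs) ≡ sum (map f xs) + sum (map g xs)
sum-map-+ []       f g = refl
sum-map-+ (x ∷ xs) f g =
  trans (cong (λ s → f x + g x + s) (sum-map-+ xs f g)) (+-interchange (f x) (g x) _ _)

sum-map-*ˡ : ∀ {X : Set} (xs : List X) c f → sum (map (λ a → c * f a) xs) ≡ c * sum (map f xs)
sum-map-*ˡ []       c f = sym (*-zeroʳ c)
sum-map-*ˡ (x ∷ xs) c f = trans (cong (λ s → c * f x + s) (sum-map-*ˡ xs c f)) (sym (*-distribˡ-+ c (f x) _))

sum-map-zero : ∀ {X : Set} (xs : List X) → sum (map (λ _ → 0) xs) ≡ 0
sum-map-zero []       = refl
sum-map-zero (x ∷ xs) = sum-map-zero xs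

sum-indicator : ∀ {xs b} X → Unique xs → b ∈ xs → sum (map (λ a → if does (a ℕ.≟ b) then X else 0) xs) ≡ X
sum-indicator {x ∷ xs} X (x∉xs ∷ _) (here refl) rewrite dec-true (x ℕ.≟ x) refl =
  trans (cong (_+_ X) (trans (cong sum (map-cong-local (All.map off x∉xs))) (sum-map-zero xs))) (+-identityʳ X)
  where
  off : ∀ {a} → x ≢ a → (if does (a ℕ.≟ x) then X else 0) ≡ 0
  off x≢a rewrite dec-false (_ ℕ.≟ x) (x≢a ∘ sym) = refl
sum-indicator {x ∷ xs} {b} X (x∉xs ∷ u) (there b∈xs)
  rewrite dec-false (x ℕ.≟ b) (All.lookup x∉xs b∈xs) = sum-indicator X u b∈xs

splitsInto : ℕ → List ℕ → (List ℕ → Bool) → List ℕ → Bool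
splitsInto v p Q y = does (low v y ≟ʷ p) ∧ Q (high v y)

module Counting (A : List ℕ) (A-unique : Unique A) where

  count : ℕ → (List ℕ → Bool) → ℕ
  count zero    P = if P [] then 1 else 0
  count (suc k) P = sum (map (λ a → count k (λ y → P (a ∷ y))) A)

  count-cong : ∀ k P Q → (∀ y → length y ≡ k → P y ≡ Q y) → count k P ≡ count k Q
  count-cong zero    P Q P≡Q = cong (if_then 1 else 0) (P≡Q [] refl)
  count-cong (suc k) P Q P≡Q =
    cong sum (map-cong (λ a → count-cong k _ _ (λ y len → P≡Q (a ∷ y) (cong suc len))) A)

  count-false : ∀ k P → (∀ y → length y ≡ k → P y ≡ false) → count k P ≡ 0
  count-false zero    P P≡false rewrite P≡false [] refl = refl
  count-false (suc k) P P≡false =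
    trans (cong sum (map-cong (λ a → count-false k _ (λ y len → P≡false (a ∷ y) (cong suc len))) A))
          (sum-map-zero A)

  count-∨ : ∀ k P Q R → (∀ y → length y ≡ k → P y ∧ Q y ≡ false) → (∀ y → length y ≡ k → R y ≡ P y ∨ Q y) →
            count k P + count k Q ≡ count k R
  count-∨ zero P Q R disjoint R≡ rewrite R≡ [] refl = indicator-∨ (P []) (Q []) (disjoint [] refl)
    where
    indicator-∨ : ∀ p q → p ∧ q ≡ false → (if p then 1 else 0) + (if q then 1 else 0) ≡ (if p ∨ q then 1 else 0)
    indicator-∨ false false _ = refl
    indicator-∨ false true  _ = refl
    indicator-∨ true  false _ = refl
  count-∨ (suc k) P Q R disjoint R≡ =
    trans (sym (sum-map-+ A _ _))
          (cong sum (map-cong (λ a → count-∨ k _ _ _ (λ y len → disjoint (a ∷ y) (cong suc len))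
                                                       (λ y len → R≡ (a ∷ y) (cong suc len))) A))

  count-∧ˡ : ∀ k c P → count k (λ y → c ∧ P y) ≡ (if c then count k P else 0)
  count-∧ˡ k true  P = refl
  count-∧ˡ k false P = count-false k _ (λ _ _ → refl)

  count-≡ : ∀ p → All (_∈ A) p → count (length p) (λ y → does (y ≟ʷ p)) ≡ 1
  count-≡ []      _            = refl
  count-≡ (b ∷ p) (b∈A ∷ p∈A) = begin
    sum (map (λ a → count (length p) (λ y → does (a ℕ.≟ b) ∧ does (y ≟ʷ p))) A)
      ≡⟨ cong sum (map-cong (λ a → count-∧ˡ (length p) (does (a ℕ.≟ b)) _) A) ⟩
    sum (map (λ a → if does (a ℕ.≟ b) then count (length p) (λ y → does (y ≟ʷ p)) else 0) A)
      ≡⟨ sum-indicator _ A-unique b∈A ⟩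
    count (length p) (λ y → does (y ≟ʷ p))
      ≡⟨ count-≡ p p∈A ⟩
    1 ∎
    where open ≡-Reasoning

  count-splitsInto-∷ : ∀ v b p N Q a → b ≤ v → (∀ z → Q z ≡ true → All (v <_) z) →
    count N (λ y → splitsInto v (b ∷ p) Q (a ∷ y))
    ≡ (if does (a ℕ.≟ b) then count N (splitsInto v p Q) else 0) + count N (splitsInto v (b ∷ p) (λ z → Q (a ∷ z)))
  count-splitsInto-∷ v b p N Q a b≤v Q⇒above with a ≤? v
  ... | no a≰v rewrite dec-false (a ℕ.≟ b) (λ { refl → a≰v b≤v }) = refl
  ... | yes a≤v = begin
    count N (λ y → (does (a ℕ.≟ b) ∧ does (low v y ≟ʷ p)) ∧ Q (high v y))
      ≡⟨ count-cong N _ _ (λ y _ → Bool.∧-assoc (does (a ℕ.≟ b)) (does (low v y ≟ʷ p)) (Q (high v y))) ⟩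
    count N (λ y → does (a ℕ.≟ b) ∧ splitsInto v p Q y)
      ≡⟨ count-∧ˡ N (does (a ℕ.≟ b)) (splitsInto v p Q) ⟩
    (if does (a ℕ.≟ b) then count N (splitsInto v p Q) else 0)
      ≡⟨ +-identityʳ _ ⟨
    (if does (a ℕ.≟ b) then count N (splitsInto v p Q) else 0) + 0
      ≡⟨ cong (_+_ (if does (a ℕ.≟ b) then count N (splitsInto v p Q) else 0)) noHighStart ⟨
    (if does (a ℕ.≟ b) then count N (splitsInto v p Q) else 0) + count N (splitsInto v (b ∷ p) (λ z → Q (a ∷ z))) ∎
    where
    open ≡-Reasoning
    Qₐ-false : ∀ z → Q (a ∷ z) ≡ false
    Qₐ-false z with Q (a ∷ z) in eq
    ... | false = refl
    ... | true  = contradiction a≤v (<⇒≱ (All.head (Q⇒above (a ∷ z) eq)))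
    noHighStart : count N (splitsInto v (b ∷ p) (λ z → Q (a ∷ z))) ≡ 0
    noHighStart = count-false N _ (λ y _ → trans (cong (does (low v y ≟ʷ (b ∷ p)) ∧_) (Qₐ-false (high v y)))
                                                (Bool.∧-zeroʳ _))

  count-splitsInto-short : ∀ v b p Q → count (length p) (splitsInto v (b ∷ p) Q) ≡ 0
  count-splitsInto-short v b p Q = count-false (length p) _ short
    where
    short : ∀ y → length y ≡ length p → splitsInto v (b ∷ p) Q y ≡ false
    short y len rewrite dec-false (low v y ≟ʷ (b ∷ p)) λ low≡ →
      <-irrefl refl (≤-trans (≤-reflexive (cong length (sym low≡))) (≤-trans (length-low v y) (≤-reflexive len)))
      = refl

  count-shuffle : ∀ v p k Q → All (_≤ v) p → All (_∈ A) p → (∀ z → Q z ≡ true → All (v <_) z) →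
    count (length p + k) (splitsInto v p Q) ≡ shuffles (length p) k * count k Q
  count-shuffle v [] k Q _ _ Q⇒above =
    trans (count-cong k _ Q onlyHigh) (sym (+-identityʳ (count k Q)))
    where
    onlyHigh : ∀ y → length y ≡ k → splitsInto v [] Q y ≡ Q y
    onlyHigh y _ with low v y in low≡
    ... | [] rewrite high-all v y (low-none⁻ v y low≡) = refl
    ... | _ ∷ _ with Q y in Qy
    ...   | false = refl
    ...   | true  = contradiction (trans (sym low≡) (low-none v y (Q⇒above y Qy))) λ ()
  count-shuffle v (b ∷ p) k Q (b≤v ∷ p≤v) (b∈A ∷ p∈A) Q⇒above = begin
    sum (map (λ a → count (length p + k) (λ y → splitsInto v (b ∷ p) Q (a ∷ y))) A)
      ≡⟨ cong sum (map-cong (λ a → count-splitsInto-∷ v b p (length p + k) Q a b≤v Q⇒above) A) ⟩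
    sum (map (λ a → (if does (a ℕ.≟ b) then X else 0) + highStart k a) A)
      ≡⟨ sum-map-+ A _ (highStart k) ⟩
    sum (map (λ a → if does (a ℕ.≟ b) then X else 0) A) + sum (map (highStart k) A)
      ≡⟨ cong (_+ sum (map (highStart k) A)) (sum-indicator X A-unique b∈A) ⟩
    X + sum (map (highStart k) A)
      ≡⟨ cong (_+ sum (map (highStart k) A)) (count-shuffle v p k Q p≤v p∈A Q⇒above) ⟩
    shuffles (length p) k * count k Q + sum (map (highStart k) A)
      ≡⟨ pascal k ⟩
    shuffles (suc (length p)) k * count k Q ∎
    where
    open ≡-Reasoning
    X : ℕ
    X = count (length p + k) (splitsInto v p Q)
    highStart : ℕ → ℕ → ℕ
    highStart k a = count (length p + k) (splitsInto v (b ∷ p) (λ z → Q (a ∷ z)))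

    pascal : ∀ k → shuffles (length p) k * count k Q + sum (map (highStart k) A) ≡ shuffles (suc (length p)) k * count k Q
    pascal zero = begin
      shuffles (length p) 0 * count 0 Q + sum (map (highStart 0) A)
        ≡⟨ cong₂ (λ s t → s * count 0 Q + t) (shuffles-zeroʳ (length p)) (trans (cong sum (map-cong short A)) (sum-map-zero A)) ⟩
      1 * count 0 Q + 0
        ≡⟨ +-identityʳ _ ⟩
      shuffles (suc (length p)) 0 * count 0 Q ∎
      where
      short : ∀ a → highStart 0 a ≡ 0
      short a = trans (cong (λ N → count N (splitsInto v (b ∷ p) (λ z → Q (a ∷ z)))) (+-identityʳ (length p)))
                      (count-splitsInto-short v b p (λ z → Q (a ∷ z)))
    pascal (suc k) = begin
      shuffles (length p) (suc k) * count (suc k) Q + sum (map (highStart (suc k)) A)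
        ≡⟨ cong (_+_ _) (trans (cong sum (map-cong recurse A)) (sum-map-*ˡ A (shuffles (suc (length p)) k) _)) ⟩
      shuffles (length p) (suc k) * count (suc k) Q + shuffles (suc (length p)) k * count (suc k) Q
        ≡⟨ *-distribʳ-+ (count (suc k) Q) (shuffles (length p) (suc k)) (shuffles (suc (length p)) k) ⟨
      shuffles (suc (length p)) (suc k) * count (suc k) Q ∎
      where
      recurse : ∀ a → highStart (suc k) a ≡ shuffles (suc (length p)) k * count k (λ z → Q (a ∷ z))
      recurse a = trans (cong (λ N → count N (splitsInto v (b ∷ p) (λ z → Q (a ∷ z)))) (+-suc (length p) k))
                        (count-shuffle v (b ∷ p) k (λ z → Q (a ∷ z)) (b≤v ∷ p≤v) (b∈A ∷ p∈A)
                                       (λ z eq → All.tail (Q⇒above (a ∷ z) eq)))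

  realisations : List Cell → ℕ
  realisations X = count (length X) (λ y → does (flatQR y ≟ᶜ X))

  realisations-inRow : ∀ d q → Ascending d q → All (_∈ A) (d ∷ q) → realisations (inRow (d ∷ q)) ≡ 1
  realisations-inRow d q asc p∈A =
    trans (cong (λ N → count N (λ y → does (flatQR y ≟ᶜ inRow (d ∷ q)))) (length-map _ (d ∷ q)))
          (trans (count-cong (length (d ∷ q)) (λ y → does (flatQR y ≟ᶜ inRow (d ∷ q))) (λ y → does (y ≟ʷ (d ∷ q)))
                                (λ y _ → does-⇔ (flat⇔ y) (flatQR y ≟ᶜ inRow (d ∷ q)) (y ≟ʷ (d ∷ q))))
                 (count-≡ (d ∷ q) p∈A))
    where
    flat⇔ : ∀ y → flatQR y ≡ inRow (d ∷ q) ⇔ y ≡ d ∷ q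
    flat⇔ y = mk⇔ (flatQR-inRow⁻ y (d ∷ q)) (λ { refl → flatQR-ascending d q asc })

  realisations-rows : ∀ d q T → Ascending d q → RowsFrom true (lastOf d q) T → All (_∈ A) (concat ((d ∷ q) ∷ T)) →
    + realisations (cells ((d ∷ q) ∷ T)) ≡ alternatingSum (shape ((d ∷ q) ∷ T))
  realisations-rows d q [] asc _ p∈A = begin
    + realisations (inRow (d ∷ q) ++ [])   ≡⟨ cong (+_ ∘ realisations) (++-identityʳ (inRow (d ∷ q))) ⟩
    + realisations (inRow (d ∷ q))         ≡⟨ cong +_ (realisations-inRow d q asc (++⁻ˡ (d ∷ q) p∈A)) ⟩
    + 1                                    ≡⟨ alternatingSum-singleton (length (d ∷ q)) ⟨
    alternatingSum (length (d ∷ q) ∷ [])   ∎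
    where open ≡-Reasoning
  realisations-rows d₁ q₁ ((d₂ ∷ q₂) ∷ T) asc₁ (v<d₂ , asc₂ , rows) ∈A = begin
    + realisations XT
      ≡⟨ m+n≡o⇒m≡o-n split ⟩
    + (shuffles (length p) (length G) * realisations G) ℤ.- + realisations XF
      ≡⟨ cong₂ ℤ._-_ scaled merged ⟩
    + shuffles (length p) (length r₂ + weight (shape T)) ℤ.* alternatingSum (length r₂ ∷ shape T)
      ℤ.- alternatingSum ((length p + length r₂) ∷ shape T)
      ≡⟨ alternatingSum-∷∷ (length p) (length r₂) (shape T) ⟨
    alternatingSum (shape (p ∷ r₂ ∷ T)) ∎
    where
    open ≡-Reasoning
    p  = d₁ ∷ q₁
    r₂ = d₂ ∷ q₂
    v  = lastOf d₁ q₁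
    R  = inRow q₂ ++ laterRows T
    G  = (d₂ , false) ∷ R
    XT = inRow p ++ (d₂ , true) ∷ R
    XF = inRow p ++ (d₂ , false) ∷ R
    N  = length p + length G
    p≤v = Ascending⇒≤lastOf d₁ q₁ asc₁

    length-XT/XF : ∀ b → length (inRow p ++ (d₂ , b) ∷ R) ≡ N
    length-XT/XF b = trans (length-++ (inRow p)) (cong (_+ length G) (length-map _ p))

    G⇒above : ∀ z → does (flatQR z ≟ᶜ G) ≡ true → All (v <_) z
    G⇒above z eq with flatQR z ≟ᶜ G
    ... | yes flat≡ = flatQR-AllValues⁻ z (subst (AllValues (v <_)) (sym flat≡)
                        (cells-AllValues (r₂ ∷ T) (concat⁺ (RowsFrom⇒above (r₂ ∷ T) (v<d₂ , asc₂ , rows)))))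

    split : realisations XT + realisations XF ≡ shuffles (length p) (length G) * realisations G
    split = begin
      realisations XT + realisations XF
        ≡⟨ cong₂ _+_ (cong (λ n → count n (λ y → does (flatQR y ≟ᶜ XT))) (length-XT/XF true))
                     (cong (λ n → count n (λ y → does (flatQR y ≟ᶜ XF))) (length-XT/XF false)) ⟩
      count N (λ y → does (flatQR y ≟ᶜ XT)) + count N (λ y → does (flatQR y ≟ᶜ XF))
        ≡⟨ count-∨ N (λ y → does (flatQR y ≟ᶜ XT)) (λ y → does (flatQR y ≟ᶜ XF))
                     (splitsInto v p (λ z → does (flatQR z ≟ᶜ G))) disjoint shuffled ⟩
      count N (splitsInto v p (λ z → does (flatQR z ≟ᶜ G)))
        ≡⟨ count-shuffle v p (length G) _ p≤v (++⁻ˡ p ∈A) G⇒above ⟩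
      shuffles (length p) (length G) * realisations G ∎
      where
      XT≢XF : XT ≢ XF
      XT≢XF eq with ∷-injectiveˡ (++-cancelˡ (inRow p) _ _ eq)
      ... | ()
      disjoint : ∀ y → length y ≡ N → does (flatQR y ≟ᶜ XT) ∧ does (flatQR y ≟ᶜ XF) ≡ false
      disjoint y _ = dec-false ((flatQR y ≟ᶜ XT) ×-dec (flatQR y ≟ᶜ XF)) (λ (eT , eF) → XT≢XF (trans (sym eT) eF))
      shuffled : ∀ y → length y ≡ N →
                 splitsInto v p (λ z → does (flatQR z ≟ᶜ G)) y ≡ does (flatQR y ≟ᶜ XT) ∨ does (flatQR y ≟ᶜ XF)
      shuffled y _ = does-⇔ (flatQR-break⇔ v d₁ q₁ d₂ R y asc₁ p≤v v<d₂)
                            ((low v y ≟ʷ p) ×-dec (flatQR (high v y) ≟ᶜ G)) ((flatQR y ≟ᶜ XT) ⊎-dec (flatQR y ≟ᶜ XF))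

    scaled : + (shuffles (length p) (length G) * realisations G)
           ≡ + shuffles (length p) (length r₂ + weight (shape T)) ℤ.* alternatingSum (length r₂ ∷ shape T)
    scaled = begin
      + (shuffles (length p) (length G) * realisations G)
        ≡⟨ ℤₚ.pos-* (shuffles (length p) (length G)) (realisations G) ⟩
      + shuffles (length p) (length G) ℤ.* + realisations G
        ≡⟨ cong₂ (λ m x → + shuffles (length p) m ℤ.* x) (length-cells (r₂ ∷ T))
                 (realisations-rows d₂ q₂ T asc₂ rows (++⁻ʳ p ∈A)) ⟩
      + shuffles (length p) (length r₂ + weight (shape T)) ℤ.* alternatingSum (length r₂ ∷ shape T) ∎

    merged : + realisations XF ≡ alternatingSum ((length p + length r₂) ∷ shape T)
    merged = begin
      + realisations XF
        ≡⟨ cong (+_ ∘ realisations) (inRow-++ p r₂ (laterRows T)) ⟨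
      + realisations (cells ((p ++ r₂) ∷ T))
        ≡⟨ realisations-rows d₁ (q₁ ++ d₂ ∷ q₂) T (Ascending-++ d₁ q₁ d₂ q₂ asc₁ (<⇒≤ v<d₂) asc₂)
             (subst (λ l → RowsFrom true l T) (sym (lastOf-++ d₁ q₁ d₂ q₂)) rows)
             (subst (All (_∈ A)) (sym (++-assoc p r₂ (concat T))) ∈A) ⟩
      alternatingSum (length (p ++ r₂) ∷ shape T)
        ≡⟨ cong (λ l → alternatingSum (l ∷ shape T)) (length-++ p) ⟩
      alternatingSum ((length p + length r₂) ∷ shape T) ∎

  realisations-tableau : ∀ {b} T → RowsFrom b 0 T → All (_∈ A) (concat T) →
    + realisations (cells T) ≡ alternatingSum (shape T)
  realisations-tableau []            _              _  = refl
  realisations-tableau ((d ∷ q) ∷ T) (_ , asc , rows) ∈A = realisations-rows d q T asc rows ∈A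

length-filter-map : ∀ {X Y : Set} {P : Y → Set} (P? : Decidable P) (f : X → Y) xs →
  length (filter P? (map f xs)) ≡ length (filter (P? ∘ f) xs)
length-filter-map P? f []       = refl
length-filter-map P? f (x ∷ xs) with does (P? (f x))
... | true  = cong suc (length-filter-map P? f xs)
... | false = length-filter-map P? f xs

module _ (n : ℕ) where

  words : ℕ → List (List (Fin n))
  words zero    = [] ∷ []
  words (suc k) = cartesianProductWith _∷_ (allFin n) (words k)

  words-unique : ∀ k → Unique (words k)
  words-unique zero    = [] ∷ []
  words-unique (suc k) = Unique.cartesianProductWith⁺ _∷_ ∷-injective (Unique.allFin⁺ n) (words-unique k)

  ∈-words : ∀ u → u ∈ words (length u)
  ∈-words []      = here refl
  ∈-words (i ∷ u) = ∈-cartesianProductWith⁺ _∷_ (∈-allFin i) (∈-words u)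

  words-length : ∀ k {u} → u ∈ words k → length u ≡ k
  words-length zero    (here refl) = refl
  words-length (suc k) u∈ with ∈-cartesianProductWith⁻ _∷_ (allFin n) (words k) u∈
  ... | _ , u′ , _ , u′∈ , refl = cong suc (words-length k u′∈)

  alphabet : List ℕ
  alphabet = map letter (allFin n)

  alphabet-unique : Unique alphabet
  alphabet-unique = Unique.map⁺ (λ eq → toℕ-injective (suc-injective eq)) (Unique.allFin⁺ n)

  letters∈alphabet : ∀ (w : List (Fin n)) → All (_∈ alphabet) (map letter w)
  letters∈alphabet w = map⁺ (All.tabulate (λ {i} _ → ∈-map⁺ letter (∈-allFin i)))

  open Counting alphabet alphabet-unique using (count; realisations; realisations-tableau)

  length-filter-words : ∀ {P : List ℕ → Set} (P? : Decidable P) k →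
    length (filter (λ u → P? (map letter u)) (words k)) ≡ count k (λ y → does (P? y))
  length-filter-words P? zero with does (P? [])
  ... | true  = refl
  ... | false = refl
  length-filter-words P? (suc k) = begin
    length (filter (λ u → P? (map letter u)) (cartesianProductWith _∷_ (allFin n) (words k)))
      ≡⟨ byFirstLetter (allFin n) ⟩
    sum (map (λ i → count k (λ y → does (P? (letter i ∷ y)))) (allFin n))
      ≡⟨ cong sum (map-∘ (allFin n)) ⟩
    count (suc k) (λ y → does (P? y)) ∎
    where
    open ≡-Reasoning
    byFirstLetter : ∀ is → length (filter (λ u → P? (map letter u)) (cartesianProductWith _∷_ is (words k)))
                         ≡ sum (map (λ i → count k (λ y → does (P? (letter i ∷ y)))) is)
    byFirstLetter []       = refl
    byFirstLetter (i ∷ is) = begin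
      length (filter _ (map (i ∷_) (words k) ++ cartesianProductWith _∷_ is (words k)))
        ≡⟨ cong length (filter-++ _ (map (i ∷_) (words k)) _) ⟩
      length (filter _ (map (i ∷_) (words k)) ++ filter _ (cartesianProductWith _∷_ is (words k)))
        ≡⟨ length-++ (filter _ (map (i ∷_) (words k))) ⟩
      length (filter _ (map (i ∷_) (words k))) + length (filter _ (cartesianProductWith _∷_ is (words k)))
        ≡⟨ cong₂ _+_ (trans (length-filter-map _ (i ∷_) (words k)) (length-filter-words (λ y → P? (letter i ∷ y)) k))
                     (byFirstLetter is) ⟩
      count k (λ y → does (P? (letter i ∷ y))) + sum (map (λ i → count k (λ y → does (P? (letter i ∷ y)))) is) ∎

  QR≡toRows : ∀ (u : List (Fin n)) → QR u ≡ toRows (flatQR (map letter u))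
  QR≡toRows u = QRℕ≡toRows-flatQR (map letter u)

  QR≡⇔flatQR≡ : ∀ (u w : List (Fin n)) → QR u ≡ QR w ⇔ flatQR (map letter u) ≡ flatQR (map letter w)
  QR≡⇔flatQR≡ u w = mk⇔
    (λ eq → toRows-injective _ _ (flatQR-firstFlag (map letter u)) (flatQR-firstFlag (map letter w))
              (trans (sym (QR≡toRows u)) (trans eq (QR≡toRows w))))
    (λ eq → trans (QR≡toRows u) (trans (cong toRows eq) (sym (QR≡toRows w))))

  QR-RowsFrom : ∀ (w : List (Fin n)) → RowsFrom false 0 (QR w)
  QR-RowsFrom w = subst₂ (λ b T → RowsFrom b 0 T) (flatQR-firstFlag (map letter w)) (sym (QR≡toRows w))
                         (Ribbon⇒RowsFrom _ (insertAll-Ribbon [] (map letter w) tt))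

  concat-QR-All : ∀ {P : ℕ → Set} (w : List (Fin n)) → All P (map letter w) → All P (concat (QR w))
  concat-QR-All {P} w pw = subst (All P) (sym (trans (cong concat (QR≡toRows w)) (concat-toRows _)))
                                 (map⁺ (flatQR-AllValues (map letter w) pw))

  length-shape-QR : ∀ (w : List (Fin n)) → length (shape (QR w)) ≤ n
  length-shape-QR w = begin
    length (shape (QR w)) ≡⟨ length-map length (QR w) ⟩
    length (QR w)         ≡⟨ +-identityʳ _ ⟨
    length (QR w) + 0     ≤⟨ RowsFrom-length 0 (QR w) rowsFrom (concat-QR-All w letters≤n) z≤n ⟩
    n                     ∎
    where
    open ≤-Reasoning
    letters≤n : All (_≤ n) (map letter w)
    letters≤n = map⁺ (All.tabulate (λ {i} _ → toℕ<n i))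
    rowsFrom : RowsFrom true 0 (QR w)
    rowsFrom = RowsFrom-strict (QR w) (QR-RowsFrom w) (concat⁻ (concat-QR-All w (map⁺ (All.tabulate (λ _ → s≤s z≤n)))))

  hypoClassSize-QR : ∀ (w : List (Fin n)) → hypoClassSize n (shape (QR w)) ≡ alternatingSum (shape (QR w))
  hypoClassSize-QR w =
    cong (if_then alternatingSum (shape (QR w)) else + 0) (dec-true (length (shape (QR w)) ≤? n) (length-shape-QR w))

  class : List (Fin n) → List (List (Fin n))
  class w = filter (λ u → flatQR (map letter u) ≟ᶜ flatQR (map letter w)) (words (length w))

  class-unique : ∀ w → Unique (class w)
  class-unique w = Unique.filter⁺ _ (words-unique (length w))

  ∈-class⇔ : ∀ w u → u ∈ class w ⇔ QR u ≡ QR w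
  ∈-class⇔ w u = mk⇔
    (λ u∈ → Equivalence.from (QR≡⇔flatQR≡ u w) (proj₂ (∈-filter⁻ _ {xs = words (length w)} u∈)))
    (λ eq → let flat≡ = Equivalence.to (QR≡⇔flatQR≡ u w) eq in
            ∈-filter⁺ _ (subst (λ k → u ∈ words k) (same-length flat≡) (∈-words u)) flat≡)
    where
    open ≡-Reasoning
    same-length : flatQR (map letter u) ≡ flatQR (map letter w) → length u ≡ length w
    same-length eq = begin
      length u                         ≡⟨ length-map letter u ⟨
      length (map letter u)            ≡⟨ length-flatQR (map letter u) ⟨
      length (flatQR (map letter u))   ≡⟨ cong length eq ⟩
      length (flatQR (map letter w))   ≡⟨ length-flatQR (map letter w) ⟩
      length (map letter w)            ≡⟨ length-map letter w ⟩
      length w                         ∎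

  length-class : ∀ (w : List (Fin n)) → + length (class w) ≡ alternatingSum (shape (QR w))
  length-class w = begin
    + length (class w)
      ≡⟨ cong +_ (length-filter-words (λ y → flatQR y ≟ᶜ F) (length w)) ⟩
    + count (length w) (λ y → does (flatQR y ≟ᶜ F))
      ≡⟨ cong (λ k → + count k (λ y → does (flatQR y ≟ᶜ F)))
              (trans (sym (length-map letter w)) (sym (length-flatQR (map letter w)))) ⟩
    + realisations F
      ≡⟨ cong (+_ ∘ realisations) (cells-toRows F (flatQR-firstFlag (map letter w))) ⟨
    + realisations (cells (toRows F))
      ≡⟨ cong (λ T → + realisations (cells T)) (QR≡toRows w) ⟨
    + realisations (cells (QR w))
      ≡⟨ realisations-tableau (QR w) (QR-RowsFrom w) (concat-QR-All w (letters∈alphabet w)) ⟩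
    alternatingSum (shape (QR w)) ∎
    where
    open ≡-Reasoning
    F = flatQR (map letter w)

theorem8p2 : (n : ℕ) (α : Composition) → IsComposition α →
    (w : List (Fin n)) → shape (QR w) ≡ α →
    Σ (List (List (Fin n))) (λ L →
      Unique L × ((u : List (Fin n)) → (u ∈ L) ⇔ (QR u ≡ QR w)) ×
      (+ length L ≡ hypoClassSize n α))
theorem8p2 n _ _ w refl =
  class n w , class-unique n w , ∈-class⇔ n w , trans (length-class n w) (sym (hypoClassSize-QR n w))
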